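{- Let $e\ge0$, $n\ge2$ and $1\le j<n$ be integers, and let $x_{n-j},\dots,x_n$ be nonzero elements with $x_k\in\mathrm{GF}(2^{2\cdot3^k})$. Then $$\frac{\mathrm{N}_{n,j}(x_n)}{x_{n-j}^{2^{ej}}}=\prod_{k=1}^{j}\mathrm{N}_{n-k,j-k}\left(\frac{\mathrm{N}_{n-k+1,1}(x_{n-k+1})}{x_{n-k}^{2^e}}\right)^{2^{e(k-1)}}.$$ In particular, if $(x_k)_{k\ge1}$ is an infinite normal tower sequence for $f(x,y)=y^3+y+x^{2^e}$ (so that $f(x_{k-1},0)=x_{k-1}^{2^e}$ for all $k\ge2$), then $\mathrm{N}_{n,j}(x_n)=x_{n-j}^{2^{ej}}$.
   Context: $\mathrm{GF}(2^m)$ denotes the field with $2^m$ elements, inside a fixed algebraic closure. For $0\le j<n$, $\mathrm{N}_{n,j}\colon\mathrm{GF}(2^{2\cdot3^n})\to\mathrm{GF}(2^{2\cdot3^{n-j}})$ is the norm map $\mathrm{N}_{n,j}(x)=x^{\prod_{i=1}^{j}(4^{2\cdot3^{n-i}}+4^{3^{n-i}}+1)}$, with $\mathrm{N}_{n,0}(x)=x$. An infinite normal tower sequence for $f(x,y)=y^3+y+x^{2^e}$ is a sequence $(x_k)_{k\ge1}$ with $x_1\in\mathrm{GF}(2^6)$ such that, for every $k\ge2$, $f(x_{k-1},y)$ is irreducible over $\mathrm{GF}(2^{2\cdot3^{k-1}})$ and $x_k$ is one of its roots. -}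

module Defs where

open import Level using (Level; _⊔_)
open import Data.Nat as ℕ using (ℕ; zero; suc; _∸_; _≤_)
open import Data.List using (List; []; _∷_; map; foldr)
open import Data.List.Relation.Unary.All using (All)
open import Data.Product using (Σ; ∃; _×_; _,_)
open import Data.Sum using (_⊎_)
open import Relation.Nullary using (¬_)
open import Algebra.Bundles using (CommutativeRing)

-- An algebraically closed field of characteristic 2, algebraic over GF(2)
-- (i.e. an algebraic closure of GF(2)).  Polynomials are coefficient lists,
-- lowest degree first.
module PolyOver {c ℓ : Level} (R : CommutativeRing c ℓ) where
  open CommutativeRing R
  coeff : List Carrier → ℕ → Carrier
  coeff []       _       = 0#
  coeff (a ∷ p)  zero    = a
  coeff (a ∷ p)  (suc i) = coeff p i
  eval : List Carrier → Carrier → Carrier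
  eval p a = foldr (λ c acc → c + a * acc) 0# p
  NonConstant : List Carrier → Set ℓ
  NonConstant p = Σ ℕ λ i → (1 ≤ i) × ¬ (coeff p i ≈ 0#)
  NonZeroPoly : List Carrier → Set ℓ
  NonZeroPoly p = Σ ℕ λ i → ¬ (coeff p i ≈ 0#)

record ACF2 (c ℓ : Level) : Set (Level.suc (c ⊔ ℓ)) where
  field
    cring : CommutativeRing c ℓ
  open CommutativeRing cring public
  open PolyOver cring public
  field
    _⁻¹       : Carrier → Carrier
    inverseʳ  : ∀ x → ¬ (x ≈ 0#) → x * (x ⁻¹) ≈ 1#
    0≉1       : ¬ (0# ≈ 1#)
    char2     : 1# + 1# ≈ 0#
    algClosed : ∀ p → NonConstant p → Σ Carrier λ a → eval p a ≈ 0#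
    algebraic : ∀ a → Σ (List Carrier) λ p →
                  All (λ c → (c ≈ 0#) ⊎ (c ≈ 1#)) p × NonZeroPoly p × (eval p a ≈ 0#)

module Over {c ℓ : Level} (K : ACF2 c ℓ) where
  open ACF2 K public

  infixr 8 _^_
  _^_ : Carrier → ℕ → Carrier
  a ^ zero  = 1#
  a ^ suc m = a * (a ^ m)

  infixl 7 _/_
  _/_ : Carrier → Carrier → Carrier
  a / b = a * (b ⁻¹)

  InGF : ℕ → Carrier → Set ℓ
  InGF m a = a ^ (2 ℕ.^ m) ≈ a

  normExp : ℕ → ℕ → ℕ
  normExp n zero    = 1
  normExp n (suc j) = normExp n j ℕ.* (4 ℕ.^ (2 ℕ.* 3 ℕ.^ (n ∸ suc j)) ℕ.+ 4 ℕ.^ (3 ℕ.^ (n ∸ suc j)) ℕ.+ 1)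

  N : ℕ → ℕ → Carrier → Carrier
  N n j a = a ^ normExp n j

  prodTo : ℕ → (ℕ → Carrier) → Carrier
  prodTo zero    f = 1#
  prodTo (suc j) f = prodTo j f * f (suc j)

  _+ₚ_ : List Carrier → List Carrier → List Carrier
  []      +ₚ q       = q
  (a ∷ p) +ₚ []      = a ∷ p
  (a ∷ p) +ₚ (b ∷ q) = (a + b) ∷ (p +ₚ q)

  _*ₚ_ : List Carrier → List Carrier → List Carrier
  []      *ₚ q = []
  (a ∷ p) *ₚ q = map (a *_) q +ₚ (0# ∷ (p *ₚ q))

  ReducibleOver : (Carrier → Set ℓ) → List Carrier → Set (c ⊔ ℓ)
  ReducibleOver S p = Σ (List Carrier) λ g → Σ (List Carrier) λ h →
    All S g × All S h × NonConstant g × NonConstant h ×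
    (∀ i → coeff p i ≈ coeff (g *ₚ h) i)

  IrreducibleOver : (Carrier → Set ℓ) → List Carrier → Set (c ⊔ ℓ)
  IrreducibleOver S p = All S p × NonConstant p × ¬ ReducibleOver S p

  fpoly : ℕ → Carrier → List Carrier
  fpoly e a = (a ^ (2 ℕ.^ e)) ∷ 1# ∷ 0# ∷ 1# ∷ []

  -- infinite normal tower sequence (x_k)_{k≥1} (x 0 is unused)
  NormalTower : ℕ → (ℕ → Carrier) → Set (c ⊔ ℓ)
  NormalTower e x = InGF 6 (x 1) ×
    (∀ k → 2 ≤ k → IrreducibleOver (InGF (2 ℕ.* 3 ℕ.^ (k ∸ 1))) (fpoly e (x (k ∸ 1)))
                   × (eval (fpoly e (x (k ∸ 1))) (x k) ≈ 0#))

-- Put T_k = N_{n-k,j-k}(x_{n-k})^{2^{ek}}.  Since N_{m+1,t+1} = N_{m,t} ∘ N_{m+1,1} and the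
-- norm is multiplicative, the k-th factor times T_k is T_{k-1}, so the product telescopes
-- to T_0 / T_j = N_{n,j}(x_n) / x_{n-j}^{2^{ej}}.  In a normal tower every factor is 1:
-- x_{m+1} is a root r of y³ + y + a, a = x_m^{2^e}, irreducible over GF(2^M), M = 2·3^m,
-- so its conjugates r, r^Q, r^{Q²} (Q = 2^M) are pairwise distinct (a coincidence would
-- give a linear or quadratic factor over GF(2^M)), and in characteristic 2 three distinct
-- roots of y³ + y + a have product a.  Hence N_{m+1,1}(x_{m+1}) = r^{Q²+Q+1} = a.
module Submission where

open import Defs
open import Level using (Level)
open import Data.Nat as ℕ using (ℕ; zero; suc; _∸_; _≤_; _<_; z≤n; s≤s)
import Data.Nat.Properties as ℕ
open import Data.List using (List; []; _∷_)
open import Data.List.Relation.Unary.All using ([]; _∷_)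
open import Data.Product using (_×_; _,_; proj₁; proj₂)
open import Relation.Nullary using (¬_)
open import Relation.Binary.PropositionalEquality as ≡ using (_≡_)
import Algebra.Properties.CommutativeSemiring.Exp as SemiringExp
import Algebra.Solver.Ring.NaturalCoefficients.Default as NaturalCoefficientsSolver
import Relation.Binary.Reasoning.Setoid as SetoidReasoning

module _ {c ℓ : Level} (K : ACF2 c ℓ) where
  open Over K
  open NaturalCoefficientsSolver commutativeSemiring
  open SetoidReasoning setoid
  private
    module Exp = SemiringExp commutativeSemiring

  ^≈^ᴱ : ∀ a n → a ^ n ≈ a Exp.^ n
  ^≈^ᴱ a zero    = refl
  ^≈^ᴱ a (suc n) = *-congˡ (^≈^ᴱ a n)

  ^-congˡ : ∀ n {a b} → a ≈ b → a ^ n ≈ b ^ n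
  ^-congˡ n {a} {b} a≈b = trans (^≈^ᴱ a n) (trans (Exp.^-congˡ n a≈b) (sym (^≈^ᴱ b n)))

  ^-congʳ : ∀ a {m n} → m ≡ n → a ^ m ≈ a ^ n
  ^-congʳ a ≡.refl = refl

  ^-homo-* : ∀ a m n → a ^ (m ℕ.+ n) ≈ a ^ m * a ^ n
  ^-homo-* a m n =
    trans (^≈^ᴱ a (m ℕ.+ n)) (trans (Exp.^-homo-* a m n) (sym (*-cong (^≈^ᴱ a m) (^≈^ᴱ a n))))

  ^-assocʳ : ∀ a m n → (a ^ m) ^ n ≈ a ^ (m ℕ.* n)
  ^-assocʳ a m n = begin
    (a ^ m) ^ n         ≈⟨ ^≈^ᴱ (a ^ m) n ⟩
    (a ^ m) Exp.^ n     ≈⟨ Exp.^-congˡ n (^≈^ᴱ a m) ⟩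
    (a Exp.^ m) Exp.^ n ≈⟨ Exp.^-assocʳ a m n ⟩
    a Exp.^ (m ℕ.* n)   ≈⟨ ^≈^ᴱ a (m ℕ.* n) ⟨
    a ^ (m ℕ.* n)       ∎

  ^-distrib-* : ∀ a b n → (a * b) ^ n ≈ a ^ n * b ^ n
  ^-distrib-* a b n =
    trans (^≈^ᴱ (a * b) n) (trans (Exp.^-distrib-* a b n) (sym (*-cong (^≈^ᴱ a n) (^≈^ᴱ b n))))

  ^-identityʳ : ∀ a → a ^ 1 ≈ a
  ^-identityʳ a = *-identityʳ a

  1^≈1 : ∀ n → 1# ^ n ≈ 1#
  1^≈1 zero    = refl
  1^≈1 (suc n) = trans (*-identityˡ _) (1^≈1 n)

  ^-comm : ∀ a m n → (a ^ m) ^ n ≈ (a ^ n) ^ m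
  ^-comm a m n =
    trans (^-assocʳ a m n) (trans (^-congʳ a (ℕ.*-comm m n)) (sym (^-assocʳ a n m)))

  *≈0⇒≈0 : ∀ {a b} → ¬ a ≈ 0# → a * b ≈ 0# → b ≈ 0#
  *≈0⇒≈0 {a} {b} a≉0 ab≈0 = begin
    b              ≈⟨ *-identityˡ b ⟨
    1# * b         ≈⟨ *-congʳ (inverseʳ a a≉0) ⟨
    a * a ⁻¹ * b   ≈⟨ solve 3 (λ a a⁻¹ b → a :* a⁻¹ :* b := a⁻¹ :* (a :* b)) refl a (a ⁻¹) b ⟩
    a ⁻¹ * (a * b) ≈⟨ *-congˡ ab≈0 ⟩
    a ⁻¹ * 0#      ≈⟨ zeroʳ _ ⟩
    0#             ∎

  ^-nonzero : ∀ {a} → ¬ a ≈ 0# → ∀ n → ¬ a ^ n ≈ 0#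
  ^-nonzero a≉0 zero    1≈0    = 0≉1 (sym 1≈0)
  ^-nonzero a≉0 (suc n) aa^n≈0 = ^-nonzero a≉0 n (*≈0⇒≈0 a≉0 aa^n≈0)

  /-*-inverse : ∀ a {b} → ¬ b ≈ 0# → a / b * b ≈ a
  /-*-inverse a {b} b≉0 = begin
    a * b ⁻¹ * b   ≈⟨ *-assoc a (b ⁻¹) b ⟩
    a * (b ⁻¹ * b) ≈⟨ *-congˡ (trans (*-comm _ _) (inverseʳ b b≉0)) ⟩
    a * 1#         ≈⟨ *-identityʳ a ⟩
    a              ∎

  *-/-inverse : ∀ a {b} → ¬ b ≈ 0# → a * b / b ≈ a
  *-/-inverse a {b} b≉0 = begin
    a * b * b ⁻¹   ≈⟨ *-assoc a b (b ⁻¹) ⟩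
    a * (b * b ⁻¹) ≈⟨ *-congˡ (inverseʳ b b≉0) ⟩
    a * 1#         ≈⟨ *-identityʳ a ⟩
    a              ∎

  2*≈0 : ∀ a → (1# + 1#) * a ≈ 0#
  2*≈0 a = trans (*-congʳ char2) (zeroˡ a)

  x+x≈0 : ∀ a → a + a ≈ 0#
  x+x≈0 a = trans (solve 1 (λ a → a :+ a := (con 1 :+ con 1) :* a) refl a) (2*≈0 a)

  +≈0⇒≈ : ∀ {a b} → a + b ≈ 0# → a ≈ b
  +≈0⇒≈ {a} {b} a+b≈0 = begin
    a           ≈⟨ +-identityʳ a ⟨
    a + 0#      ≈⟨ +-congˡ (x+x≈0 b) ⟨
    a + (b + b) ≈⟨ +-assoc a b b ⟨
    a + b + b   ≈⟨ +-congʳ a+b≈0 ⟩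
    0# + b      ≈⟨ +-identityˡ b ⟩
    b           ∎

  square-+ : ∀ a b → (a + b) ^ 2 ≈ a ^ 2 + b ^ 2
  square-+ a b = begin
    (a + b) ^ 2                         ≈⟨ solve 2 (λ a b → (a :+ b) :* ((a :+ b) :* con 1) :=
                                             a :* (a :* con 1) :+ b :* (b :* con 1) :+ (con 1 :+ con 1) :* (a :* b))
                                             refl a b ⟩
    a ^ 2 + b ^ 2 + (1# + 1#) * (a * b) ≈⟨ +-congˡ (2*≈0 _) ⟩
    a ^ 2 + b ^ 2 + 0#                  ≈⟨ +-identityʳ _ ⟩
    a ^ 2 + b ^ 2                       ∎

  frobenius-+ : ∀ M a b → (a + b) ^ (2 ℕ.^ M) ≈ a ^ (2 ℕ.^ M) + b ^ (2 ℕ.^ M)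
  frobenius-+ zero    a b = trans (^-identityʳ _) (sym (+-cong (^-identityʳ a) (^-identityʳ b)))
  frobenius-+ (suc M) a b = begin
    (a + b) ^ (2 ℕ.* Q)       ≈⟨ ^-assocʳ (a + b) 2 Q ⟨
    ((a + b) ^ 2) ^ Q         ≈⟨ ^-congˡ Q (square-+ a b) ⟩
    (a ^ 2 + b ^ 2) ^ Q       ≈⟨ frobenius-+ M (a ^ 2) (b ^ 2) ⟩
    (a ^ 2) ^ Q + (b ^ 2) ^ Q ≈⟨ +-cong (^-assocʳ a 2 Q) (^-assocʳ b 2 Q) ⟩
    a ^ (2 ℕ.* Q) + b ^ (2 ℕ.* Q) ∎
    where Q = 2 ℕ.^ M

  frobenius-≉ : ∀ M {a b} → ¬ a ≈ b → ¬ a ^ (2 ℕ.^ M) ≈ b ^ (2 ℕ.^ M)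
  frobenius-≉ M {a} {b} a≉b a^Q≈b^Q = ^-nonzero (λ a+b≈0 → a≉b (+≈0⇒≈ a+b≈0)) Q (begin
    (a + b) ^ Q   ≈⟨ frobenius-+ M a b ⟩
    a ^ Q + b ^ Q ≈⟨ +-congʳ a^Q≈b^Q ⟩
    b ^ Q + b ^ Q ≈⟨ x+x≈0 _ ⟩
    0#            ∎)
    where Q = 2 ℕ.^ M

  InGF-0 : ∀ M → InGF M 0#
  InGF-0 M = trans (^-congˡ (2 ℕ.^ M) (sym (+-identityʳ 0#))) (trans (frobenius-+ M 0# 0#) (x+x≈0 _))

  InGF-1 : ∀ M → InGF M 1#
  InGF-1 M = 1^≈1 (2 ℕ.^ M)

  InGF-+ : ∀ M {a b} → InGF M a → InGF M b → InGF M (a + b)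
  InGF-+ M a∈ b∈ = trans (frobenius-+ M _ _) (+-cong a∈ b∈)

  InGF-* : ∀ M {a b} → InGF M a → InGF M b → InGF M (a * b)
  InGF-* M {a} {b} a∈ b∈ = trans (^-distrib-* a b (2 ℕ.^ M)) (*-cong a∈ b∈)

  -- fpoly e a is definitionally cubicPoly (a ^ 2 ℕ.^ e)
  cubicPoly : Carrier → List Carrier
  cubicPoly a = a ∷ 1# ∷ 0# ∷ 1# ∷ []

  cubicPoly-root : ∀ {a r} → eval (cubicPoly a) r ≈ 0# → r * r * r + r ≈ a
  cubicPoly-root {a} {r} root = +≈0⇒≈ (begin
    r * r * r + r + a      ≈⟨ solve 2 (λ a r → r :* r :* r :+ r :+ a :=
                                 a :+ r :* (con 1 :+ r :* (con 0 :+ r :* (con 1 :+ r :* con 0))))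
                                 refl a r ⟩
    eval (cubicPoly a) r   ≈⟨ root ⟩
    0#                     ∎)

  cubicPoly-reducible : ∀ {S : Carrier → Set ℓ} {a s t} → S 1# → S s → S t →
    s * s + t ≈ 1# → s * t ≈ a → ReducibleOver S (cubicPoly a)
  cubicPoly-reducible {a = a} {s} {t} S1 Ss St s²+t≈1 st≈a =
    (t ∷ s ∷ 1# ∷ []) , (s ∷ 1# ∷ []) , (St ∷ Ss ∷ S1 ∷ []) , (Ss ∷ S1 ∷ []) ,
    (2 , s≤s z≤n , λ 1≈0 → 0≉1 (sym 1≈0)) , (1 , s≤s z≤n , λ 1≈0 → 0≉1 (sym 1≈0)) , coeff-≈
    where
    coeff-≈ : ∀ i → coeff (cubicPoly a) i ≈ coeff ((t ∷ s ∷ 1# ∷ []) *ₚ (s ∷ 1# ∷ [])) i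
    coeff-≈ 0 = sym (trans (+-identityʳ _) (trans (*-comm t s) st≈a))
    coeff-≈ 1 = sym (trans (solve 2 (λ s t → t :* con 1 :+ (s :* s :+ con 0) := s :* s :+ t) refl s t) s²+t≈1)
    coeff-≈ 2 = sym (trans (solve 1 (λ s → s :* con 1 :+ (con 1 :* s :+ con 0) := (con 1 :+ con 1) :* s) refl s)
                           (2*≈0 s))
    coeff-≈ 3 = sym (*-identityˡ 1#)
    coeff-≈ (suc (suc (suc (suc i)))) = refl

  cubic-root-in-field⇒reducible : ∀ M {a r} → InGF M r → r * r * r + r ≈ a →
    ReducibleOver (InGF M) (cubicPoly a)
  cubic-root-in-field⇒reducible M {a} {r} r∈ root =
    cubicPoly-reducible (InGF-1 M) r∈ (InGF-+ M (InGF-* M r∈ r∈) (InGF-1 M)) r²+[r²+1]≈1 r[r²+1]≈a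
    where
    r²+[r²+1]≈1 : r * r + (r * r + 1#) ≈ 1#
    r²+[r²+1]≈1 = begin
      r * r + (r * r + 1#)            ≈⟨ solve 1 (λ r → r :* r :+ (r :* r :+ con 1) :=
                                           (con 1 :+ con 1) :* (r :* r) :+ con 1) refl r ⟩
      (1# + 1#) * (r * r) + 1#        ≈⟨ +-congʳ (2*≈0 _) ⟩
      0# + 1#                         ≈⟨ +-identityˡ 1# ⟩
      1#                              ∎
    r[r²+1]≈a : r * (r * r + 1#) ≈ a
    r[r²+1]≈a = trans (solve 1 (λ r → r :* (r :* r :+ con 1) := r :* r :* r :+ r) refl r) root

  cubic-distinct-roots : ∀ {a r₁ r₂} → r₁ * r₁ * r₁ + r₁ ≈ a → r₂ * r₂ * r₂ + r₂ ≈ a → ¬ r₁ ≈ r₂ →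
    r₁ * r₁ + r₁ * r₂ + r₂ * r₂ ≈ 1#
  cubic-distinct-roots {a} {r₁} {r₂} root₁ root₂ r₁≉r₂ =
    sym (+≈0⇒≈ (trans (+-comm _ _) (*≈0⇒≈0 (λ r₁+r₂≈0 → r₁≉r₂ (+≈0⇒≈ r₁+r₂≈0)) vanish)))
    where
    vanish : (r₁ + r₂) * (r₁ * r₁ + r₁ * r₂ + r₂ * r₂ + 1#) ≈ 0#
    vanish = begin
      (r₁ + r₂) * (r₁ * r₁ + r₁ * r₂ + r₂ * r₂ + 1#)
        ≈⟨ solve 2 (λ r₁ r₂ → (r₁ :+ r₂) :* (r₁ :* r₁ :+ r₁ :* r₂ :+ r₂ :* r₂ :+ con 1) :=
                     (r₁ :* r₁ :* r₁ :+ r₁) :+ (r₂ :* r₂ :* r₂ :+ r₂)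
                     :+ (con 1 :+ con 1) :* (r₁ :* r₁ :* r₂ :+ r₁ :* r₂ :* r₂)) refl r₁ r₂ ⟩
      (r₁ * r₁ * r₁ + r₁) + (r₂ * r₂ * r₂ + r₂) + (1# + 1#) * (r₁ * r₁ * r₂ + r₁ * r₂ * r₂)
        ≈⟨ +-cong (+-cong root₁ root₂) (2*≈0 _) ⟩
      a + a + 0# ≈⟨ trans (+-identityʳ _) (x+x≈0 a) ⟩
      0# ∎

  cubic-root-pair-product : ∀ {a r₁ r₂} → r₁ * r₁ * r₁ + r₁ ≈ a →
    r₁ * r₁ + r₁ * r₂ + r₂ * r₂ ≈ 1# → r₁ * r₂ * (r₁ + r₂) ≈ a
  cubic-root-pair-product {a} {r₁} {r₂} root₁ σ≈1 = begin
    r₁ * r₂ * (r₁ + r₂)                                    ≈⟨ +-identityʳ _ ⟨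
    r₁ * r₂ * (r₁ + r₂) + 0#                               ≈⟨ +-congˡ (2*≈0 _) ⟨
    r₁ * r₂ * (r₁ + r₂) + (1# + 1#) * (r₁ * r₁ * r₁)
      ≈⟨ solve 2 (λ r₁ r₂ → r₁ :* r₂ :* (r₁ :+ r₂) :+ (con 1 :+ con 1) :* (r₁ :* r₁ :* r₁) :=
                   r₁ :* r₁ :* r₁ :+ r₁ :* (r₁ :* r₁ :+ r₁ :* r₂ :+ r₂ :* r₂)) refl r₁ r₂ ⟩
    r₁ * r₁ * r₁ + r₁ * (r₁ * r₁ + r₁ * r₂ + r₂ * r₂)      ≈⟨ +-congˡ (trans (*-congˡ σ≈1) (*-identityʳ r₁)) ⟩
    r₁ * r₁ * r₁ + r₁                                      ≈⟨ root₁ ⟩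
    a                                                      ∎

  cubic-distinct-roots-product : ∀ {a r₁ r₂ r₃} →
    r₁ * r₁ * r₁ + r₁ ≈ a → r₂ * r₂ * r₂ + r₂ ≈ a → r₃ * r₃ * r₃ + r₃ ≈ a →
    ¬ r₁ ≈ r₂ → ¬ r₁ ≈ r₃ → ¬ r₂ ≈ r₃ → r₁ * r₂ * r₃ ≈ a
  cubic-distinct-roots-product {a} {r₁} {r₂} {r₃} root₁ root₂ root₃ r₁≉r₂ r₁≉r₃ r₂≉r₃ = begin
    r₁ * r₂ * r₃         ≈⟨ *-congˡ r₁+r₂≈r₃ ⟨
    r₁ * r₂ * (r₁ + r₂)  ≈⟨ cubic-root-pair-product root₁ σ₁₂≈1 ⟩
    a                    ∎
    where
    σ₁₂≈1 = cubic-distinct-roots root₁ root₂ r₁≉r₂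
    σ₁₃≈1 = cubic-distinct-roots root₁ root₃ r₁≉r₃
    vanish : (r₂ + r₃) * (r₁ + r₂ + r₃) ≈ 0#
    vanish = begin
      (r₂ + r₃) * (r₁ + r₂ + r₃)                          ≈⟨ +-identityʳ _ ⟨
      (r₂ + r₃) * (r₁ + r₂ + r₃) + 0#                     ≈⟨ +-congˡ (2*≈0 _) ⟨
      (r₂ + r₃) * (r₁ + r₂ + r₃) + (1# + 1#) * (r₁ * r₁)
        ≈⟨ solve 3 (λ r₁ r₂ r₃ → (r₂ :+ r₃) :* (r₁ :+ r₂ :+ r₃) :+ (con 1 :+ con 1) :* (r₁ :* r₁) :=
                     (r₁ :* r₁ :+ r₁ :* r₂ :+ r₂ :* r₂) :+ (r₁ :* r₁ :+ r₁ :* r₃ :+ r₃ :* r₃)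
                     :+ (con 1 :+ con 1) :* (r₂ :* r₃)) refl r₁ r₂ r₃ ⟩
      (r₁ * r₁ + r₁ * r₂ + r₂ * r₂) + (r₁ * r₁ + r₁ * r₃ + r₃ * r₃) + (1# + 1#) * (r₂ * r₃)
        ≈⟨ +-cong (+-cong σ₁₂≈1 σ₁₃≈1) (2*≈0 _) ⟩
      1# + 1# + 0#                                        ≈⟨ trans (+-identityʳ _) char2 ⟩
      0#                                                  ∎
    r₁+r₂≈r₃ : r₁ + r₂ ≈ r₃
    r₁+r₂≈r₃ = +≈0⇒≈ (*≈0⇒≈0 (λ r₂+r₃≈0 → r₂≉r₃ (+≈0⇒≈ r₂+r₃≈0)) vanish)

  frobenius-cubic-root : ∀ M {a r} → InGF M a → r * r * r + r ≈ a →
    let Q = 2 ℕ.^ M in r ^ Q * r ^ Q * r ^ Q + r ^ Q ≈ a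
  frobenius-cubic-root M {a} {r} a∈ root = begin
    r ^ Q * r ^ Q * r ^ Q + r ^ Q ≈⟨ +-congʳ (trans (^-distrib-* (r * r) r Q) (*-congʳ (^-distrib-* r r Q))) ⟨
    (r * r * r) ^ Q + r ^ Q       ≈⟨ frobenius-+ M _ r ⟨
    (r * r * r + r) ^ Q           ≈⟨ ^-congˡ Q root ⟩
    a ^ Q                         ≈⟨ a∈ ⟩
    a                             ∎
    where Q = 2 ℕ.^ M

  cubic-root-norm : ∀ M {a r} → InGF M a → ¬ ReducibleOver (InGF M) (cubicPoly a) →
    r * r * r + r ≈ a → let Q = 2 ℕ.^ M in r ^ (Q ℕ.* Q ℕ.+ Q ℕ.+ 1) ≈ a
  cubic-root-norm M {a} {r} a∈ irreducible root = begin
    r ^ (Q ℕ.* Q ℕ.+ Q ℕ.+ 1)      ≈⟨ ^-homo-* r (Q ℕ.* Q ℕ.+ Q) 1 ⟩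
    r ^ (Q ℕ.* Q ℕ.+ Q) * r ^ 1    ≈⟨ *-cong (^-homo-* r (Q ℕ.* Q) Q) (^-identityʳ r) ⟩
    r ^ (Q ℕ.* Q) * r ^ Q * r      ≈⟨ *-congʳ (*-congʳ (^-assocʳ r Q Q)) ⟨
    r₃ * r₂ * r                    ≈⟨ solve 3 (λ r₃ r₂ r → r₃ :* r₂ :* r := r :* r₂ :* r₃) refl r₃ r₂ r ⟩
    r * r₂ * r₃                    ≈⟨ cubic-distinct-roots-product root root₂ root₃ r≉r₂ r≉r₃ r₂≉r₃ ⟩
    a                              ∎
    where
    Q : ℕ
    Q = 2 ℕ.^ M
    r₂ r₃ : Carrier
    r₂ = r ^ Q
    r₃ = r₂ ^ Q
    root₂ : r₂ * r₂ * r₂ + r₂ ≈ a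
    root₂ = frobenius-cubic-root M a∈ root
    root₃ : r₃ * r₃ * r₃ + r₃ ≈ a
    root₃ = frobenius-cubic-root M a∈ root₂
    r≉r₂ : ¬ r ≈ r₂
    r≉r₂ r≈r₂ = irreducible (cubic-root-in-field⇒reducible M (sym r≈r₂) root)
    r₂≉r₃ : ¬ r₂ ≈ r₃
    r₂≉r₃ = frobenius-≉ M r≉r₂
    -- r = r₃ makes r + r₂ and r·r₂ Frobenius-fixed, so (y + r)(y + r₂) is a factor over GF(2^M)
    r≉r₃ : ¬ r ≈ r₃
    r≉r₃ r≈r₃ = irreducible (cubicPoly-reducible (InGF-1 M) sum∈ product∈ s²+t≈1 st≈a)
      where
      σ≈1 : r * r + r * r₂ + r₂ * r₂ ≈ 1#
      σ≈1 = cubic-distinct-roots root root₂ r≉r₂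
      st≈a : (r + r₂) * (r * r₂) ≈ a
      st≈a = trans (*-comm _ _) (cubic-root-pair-product root σ≈1)
      sum∈ : InGF M (r + r₂)
      sum∈ = trans (frobenius-+ M r r₂) (trans (+-congˡ (sym r≈r₃)) (+-comm _ _))
      product∈ : InGF M (r * r₂)
      product∈ = trans (^-distrib-* r r₂ Q) (trans (*-congˡ (sym r≈r₃)) (*-comm _ _))
      s²+t≈1 : (r + r₂) * (r + r₂) + r * r₂ ≈ 1#
      s²+t≈1 = begin
        (r + r₂) * (r + r₂) + r * r₂
          ≈⟨ solve 2 (λ r r₂ → (r :+ r₂) :* (r :+ r₂) :+ r :* r₂ :=
                       (r :* r :+ r :* r₂ :+ r₂ :* r₂) :+ (con 1 :+ con 1) :* (r :* r₂)) refl r r₂ ⟩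
        (r * r + r * r₂ + r₂ * r₂) + (1# + 1#) * (r * r₂) ≈⟨ +-cong σ≈1 (2*≈0 _) ⟩
        1# + 0#                                           ≈⟨ +-identityʳ 1# ⟩
        1#                                                ∎

  normExp-1 : ∀ m → let Q = 2 ℕ.^ (2 ℕ.* 3 ℕ.^ m) in normExp (suc m) 1 ≡ Q ℕ.* Q ℕ.+ Q ℕ.+ 1
  normExp-1 m = ≡.trans (ℕ.*-identityˡ _) (≡.cong₂ (λ A B → A ℕ.+ B ℕ.+ 1) 4^2u≡Q*Q 4^u≡Q)
    where
    u = 3 ℕ.^ m
    4^u≡Q : 4 ℕ.^ u ≡ 2 ℕ.^ (2 ℕ.* u)
    4^u≡Q = ℕ.^-*-assoc 2 2 u
    4^2u≡Q*Q : 4 ℕ.^ (2 ℕ.* u) ≡ 2 ℕ.^ (2 ℕ.* u) ℕ.* 2 ℕ.^ (2 ℕ.* u)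
    4^2u≡Q*Q = ≡.trans (ℕ.^-distribˡ-+-* 4 u (u ℕ.+ 0))
                 (≡.cong₂ ℕ._*_ 4^u≡Q (≡.trans (≡.cong (4 ℕ.^_) (ℕ.+-identityʳ u)) 4^u≡Q))

  normExp-suc : ∀ m t → normExp (suc m) (suc t) ≡ normExp (suc m) 1 ℕ.* normExp m t
  normExp-suc m zero    = ≡.sym (ℕ.*-identityʳ _)
  normExp-suc m (suc t) = ≡.trans (≡.cong (ℕ._* Eₘₜ) (normExp-suc m t))
                                  (ℕ.*-assoc (normExp (suc m) 1) (normExp m t) Eₘₜ)
    where Eₘₜ = 4 ℕ.^ (2 ℕ.* 3 ℕ.^ (m ∸ suc t)) ℕ.+ 4 ℕ.^ (3 ℕ.^ (m ∸ suc t)) ℕ.+ 1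

  N-∘ : ∀ m t a → N (suc m) (suc t) a ≈ N m t (N (suc m) 1 a)
  N-∘ m t a = trans (^-congʳ a (normExp-suc m t)) (sym (^-assocʳ a (normExp (suc m) 1) (normExp m t)))

  N-distrib-* : ∀ m t a b → N m t (a * b) ≈ N m t a * N m t b
  N-distrib-* m t a b = ^-distrib-* a b (normExp m t)

  N-^ : ∀ m t a k → N m t (a ^ k) ≈ N m t a ^ k
  N-^ m t a k = ^-comm a k (normExp m t)

  N-1 : ∀ m t → N m t 1# ≈ 1#
  N-1 m t = 1^≈1 (normExp m t)

  prodTo-telescope : ∀ (f T : ℕ → Carrier) j → (∀ k → k < j → f (suc k) * T (suc k) ≈ T k) →
    prodTo j f * T j ≈ T 0
  prodTo-telescope f T zero    step = *-identityˡ (T 0)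
  prodTo-telescope f T (suc j) step = begin
    prodTo j f * f (suc j) * T (suc j)   ≈⟨ *-assoc _ _ _ ⟩
    prodTo j f * (f (suc j) * T (suc j)) ≈⟨ *-congˡ (step j ℕ.≤-refl) ⟩
    prodTo j f * T j                     ≈⟨ prodTo-telescope f T j (λ k k<j → step k (ℕ.m<n⇒m<1+n k<j)) ⟩
    T 0                                  ∎

  prodTo-≈1 : ∀ j (f : ℕ → Carrier) → (∀ k → 1 ≤ k → k ≤ j → f k ≈ 1#) → prodTo j f ≈ 1#
  prodTo-≈1 zero    f f≈1 = refl
  prodTo-≈1 (suc j) f f≈1 =
    trans (*-cong (prodTo-≈1 j f (λ k 1≤k k≤j → f≈1 k 1≤k (ℕ.m≤n⇒m≤1+n k≤j))) (f≈1 (suc j) (s≤s z≤n) ℕ.≤-refl))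
          (*-identityˡ 1#)

  normQuotient : ℕ → (ℕ → Carrier) → ℕ → Carrier
  normQuotient e x m = N (suc m) 1 (x (suc m)) / x m ^ (2 ℕ.^ e)

  norm-telescope : ∀ e n j → j < n → (x : ℕ → Carrier) → (∀ k → n ∸ j ≤ k → k ≤ n → ¬ x k ≈ 0#) →
    N n j (x n) / x (n ∸ j) ^ (2 ℕ.^ (e ℕ.* j))
      ≈ prodTo j (λ k → N (n ∸ k) (j ∸ k) (normQuotient e x (n ∸ k)) ^ (2 ℕ.^ (e ℕ.* (k ∸ 1))))
  norm-telescope e n j j<n x x≉0 = begin
    N n j (x n) / W       ≈⟨ *-congʳ (trans (sym T₀≈) (sym (prodTo-telescope f T j step))) ⟩
    prodTo j f * T j / W  ≈⟨ *-congʳ (*-congˡ Tⱼ≈W) ⟩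
    prodTo j f * W / W    ≈⟨ *-/-inverse (prodTo j f) W≉0 ⟩
    prodTo j f            ∎
    where
    W : Carrier
    W = x (n ∸ j) ^ (2 ℕ.^ (e ℕ.* j))
    W≉0 : ¬ W ≈ 0#
    W≉0 = ^-nonzero (x≉0 (n ∸ j) ℕ.≤-refl (ℕ.m∸n≤m n j)) (2 ℕ.^ (e ℕ.* j))
    f T : ℕ → Carrier
    f k = N (n ∸ k) (j ∸ k) (normQuotient e x (n ∸ k)) ^ (2 ℕ.^ (e ℕ.* (k ∸ 1)))
    T k = N (n ∸ k) (j ∸ k) (x (n ∸ k)) ^ (2 ℕ.^ (e ℕ.* k))
    T₀≈ : T 0 ≈ N n j (x n)
    T₀≈ = trans (^-congʳ _ (≡.cong (2 ℕ.^_) (ℕ.*-zeroʳ e))) (^-identityʳ _)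
    Tⱼ≈W : T j ≈ W
    Tⱼ≈W = ^-congˡ (2 ℕ.^ (e ℕ.* j))
             (trans (^-congʳ _ (≡.cong (normExp (n ∸ j)) (ℕ.n∸n≡0 j))) (^-identityʳ _))
    step : ∀ k → k < j → f (suc k) * T (suc k) ≈ T k
    step k k<j = begin
      f (suc k) * T (suc k)               ≈⟨ *-congˡ T[k+1]≈ ⟩
      N m t q ^ C * N m t w ^ C           ≈⟨ ^-distrib-* _ _ C ⟨
      (N m t q * N m t w) ^ C             ≈⟨ ^-congˡ C (N-distrib-* m t q w) ⟨
      N m t (q * w) ^ C                   ≈⟨ ^-congˡ C (^-congˡ (normExp m t) (/-*-inverse _ w≉0)) ⟩
      N m t (N (suc m) 1 (x (suc m))) ^ C ≈⟨ ^-congˡ C (N-∘ m t (x (suc m))) ⟨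
      N (suc m) (suc t) (x (suc m)) ^ C   ≡⟨ ≡.cong₂ (λ u v → N u v (x u) ^ C) (≡.sym n∸k≡) (≡.sym j∸k≡) ⟩
      T k                                 ∎
      where
      m t C : ℕ
      m = n ∸ suc k
      t = j ∸ suc k
      C = 2 ℕ.^ (e ℕ.* k)
      q w : Carrier
      q = normQuotient e x m
      w = x m ^ (2 ℕ.^ e)
      n∸k≡ : n ∸ k ≡ suc m
      n∸k≡ = ℕ.+-∸-assoc 1 (ℕ.<-trans k<j j<n)
      j∸k≡ : j ∸ k ≡ suc t
      j∸k≡ = ℕ.+-∸-assoc 1 k<j
      w≉0 : ¬ w ≈ 0#
      w≉0 = ^-nonzero (x≉0 m (ℕ.∸-monoʳ-≤ n k<j) (ℕ.m∸n≤m n (suc k))) (2 ℕ.^ e)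
      T[k+1]≈ : T (suc k) ≈ N m t w ^ C
      T[k+1]≈ = begin
        N m t (x m) ^ (2 ℕ.^ (e ℕ.* suc k)) ≡⟨ ≡.cong (N m t (x m) ^_) (≡.cong (2 ℕ.^_) (ℕ.*-suc e k)) ⟩
        N m t (x m) ^ (2 ℕ.^ (e ℕ.+ e ℕ.* k)) ≡⟨ ≡.cong (N m t (x m) ^_) (ℕ.^-distribˡ-+-* 2 e (e ℕ.* k)) ⟩
        N m t (x m) ^ (2 ℕ.^ e ℕ.* C)       ≈⟨ ^-assocʳ _ (2 ℕ.^ e) C ⟨
        (N m t (x m) ^ (2 ℕ.^ e)) ^ C       ≈⟨ ^-congˡ C (N-^ m t (x m) (2 ℕ.^ e)) ⟨
        N m t w ^ C                         ∎

  module _ (e : ℕ) (x : ℕ → Carrier) (tower : NormalTower e x) where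

    tower-irreducible : ∀ m → 1 ≤ m →
      IrreducibleOver (InGF (2 ℕ.* 3 ℕ.^ m)) (cubicPoly (x m ^ (2 ℕ.^ e)))
    tower-irreducible m 1≤m = proj₁ (proj₂ tower (suc m) (s≤s 1≤m))

    tower-root : ∀ m → 1 ≤ m → x (suc m) * x (suc m) * x (suc m) + x (suc m) ≈ x m ^ (2 ℕ.^ e)
    tower-root m 1≤m = cubicPoly-root (proj₂ (proj₂ tower (suc m) (s≤s 1≤m)))

    tower-nonzero : ∀ m → 1 ≤ m → ¬ x m ≈ 0#
    tower-nonzero m 1≤m x≈0 = proj₂ (proj₂ (tower-irreducible m 1≤m))
      (cubic-root-in-field⇒reducible (2 ℕ.* 3 ℕ.^ m) (InGF-0 (2 ℕ.* 3 ℕ.^ m)) 0-root)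
      where
      0-root : 0# * 0# * 0# + 0# ≈ x m ^ (2 ℕ.^ e)
      0-root = trans (+-identityʳ _) (trans (zeroʳ _) (sym (trans (^-congˡ (2 ℕ.^ e) x≈0) (InGF-0 e))))

    tower-norm-step : ∀ m → 1 ≤ m → N (suc m) 1 (x (suc m)) ≈ x m ^ (2 ℕ.^ e)
    tower-norm-step m 1≤m with tower-irreducible m 1≤m
    ... | a∈ ∷ _ , _ , irreducible = trans (^-congʳ (x (suc m)) (normExp-1 m))
          (cubic-root-norm (2 ℕ.* 3 ℕ.^ m) a∈ irreducible (tower-root m 1≤m))

    tower-normQuotient : ∀ m → 1 ≤ m → normQuotient e x m ≈ 1#
    tower-normQuotient m 1≤m = trans (*-congʳ (tower-norm-step m 1≤m))
                                     (inverseʳ _ (^-nonzero (tower-nonzero m 1≤m) (2 ℕ.^ e)))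

    tower-norm : ∀ n j → 1 ≤ j → j < n → N n j (x n) ≈ x (n ∸ j) ^ (2 ℕ.^ (e ℕ.* j))
    tower-norm n j 1≤j j<n = begin
      N n j (x n)         ≈⟨ /-*-inverse _ (^-nonzero (x≉0 (n ∸ j) ℕ.≤-refl (ℕ.m∸n≤m n j)) (2 ℕ.^ (e ℕ.* j))) ⟨
      N n j (x n) / W * W ≈⟨ *-congʳ (trans (norm-telescope e n j j<n x x≉0) (prodTo-≈1 j _ factor≈1)) ⟩
      1# * W              ≈⟨ *-identityˡ W ⟩
      W                   ∎
      where
      W : Carrier
      W = x (n ∸ j) ^ (2 ℕ.^ (e ℕ.* j))
      x≉0 : ∀ k → n ∸ j ≤ k → k ≤ n → ¬ x k ≈ 0#
      x≉0 k n∸j≤k _ = tower-nonzero k (ℕ.≤-trans (ℕ.m<n⇒0<n∸m j<n) n∸j≤k)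
      factor≈1 : ∀ k → 1 ≤ k → k ≤ j →
        N (n ∸ k) (j ∸ k) (normQuotient e x (n ∸ k)) ^ (2 ℕ.^ (e ℕ.* (k ∸ 1))) ≈ 1#
      factor≈1 k _ k≤j = begin
        N (n ∸ k) (j ∸ k) (normQuotient e x (n ∸ k)) ^ C ≈⟨ ^-congˡ C (^-congˡ (normExp (n ∸ k) (j ∸ k)) quotient≈1) ⟩
        N (n ∸ k) (j ∸ k) 1# ^ C                         ≈⟨ ^-congˡ C (N-1 (n ∸ k) (j ∸ k)) ⟩
        1# ^ C                                           ≈⟨ 1^≈1 C ⟩
        1#                                               ∎
        where
        C : ℕ
        C = 2 ℕ.^ (e ℕ.* (k ∸ 1))
        quotient≈1 : normQuotient e x (n ∸ k) ≈ 1#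
        quotient≈1 = tower-normQuotient (n ∸ k) (ℕ.m<n⇒0<n∸m (ℕ.≤-<-trans k≤j j<n))

lemma4p2 : ∀ {c ℓ : Level} (K : ACF2 c ℓ) → let open Over K in
    (∀ (e n j : ℕ) → 2 ≤ n → 1 ≤ j → j < n → (x : ℕ → Carrier) →
    (∀ k → n ∸ j ≤ k → k ≤ n → ¬ (x k ≈ 0#) × InGF (2 ℕ.* 3 ℕ.^ k) (x k)) →
    N n j (x n) / x (n ∸ j) ^ (2 ℕ.^ (e ℕ.* j))
    ≈ prodTo j (λ k →
    N (n ∸ k) (j ∸ k) (N (suc (n ∸ k)) 1 (x (suc (n ∸ k))) / x (n ∸ k) ^ (2 ℕ.^ e))
    ^ (2 ℕ.^ (e ℕ.* (k ∸ 1)))))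
    × (∀ (e : ℕ) (x : ℕ → Carrier) → NormalTower e x →
    ∀ (n j : ℕ) → 2 ≤ n → 1 ≤ j → j < n →
    N n j (x n) ≈ x (n ∸ j) ^ (2 ℕ.^ (e ℕ.* j)))
lemma4p2 K =
  -- the identity holds for arbitrary nonzero x_k
  (λ e n j _ _ j<n x h → norm-telescope K e n j j<n x (λ k n∸j≤k k≤n → proj₁ (h k n∸j≤k k≤n))) ,
  (λ e x tower n j _ 1≤j j<n → tower-norm K e x tower n j 1≤j j<n)
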